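{- Let $j\ge1$ be a fixed integer. Suppose there exist a constant $C\ge1$ and a multiplicative function $\Upsilon$ such that $\Upsilon(n)$ depends only on $\nu(n)$, and such that $E_{j,k}(n)\le Ck\Upsilon(n)$ for all integers $k,n\ge1$. Then $E_{j,k}(n)\le k\Upsilon(n)$ for all integers $k,n\ge1$.
   Context: Writing $n=p_1^{v_1}\cdots p_{\omega(n)}^{v_{\omega(n)}}$ with distinct primes and $v_1\ge\dots\ge v_{\omega(n)}\ge1$, $\nu(n):=(v_1,\dots,v_{\omega(n)})$. $\mathcal{D}_n$ is the set of positive divisors of $n$. A set $U\subseteq\mathcal{D}_n^j$ is called regular if every tuple in $U$ has pairwise coprime entries. For an integer $k\ge1$, a map $g:U_g\to\mathcal{D}_n$ on a regular set $U_g\subseteq\mathcal{D}_n^j$ is $k$-regular if (0) $\gcd(g(d_1,\dots,d_j),d_i)=1$ for all $(d_1,\dots,d_j)\in U_g$ and all $i$; (1) for each $i$ and each fixed choice of the other coordinates and of $d$, the equation $g(d_1,\dots,d_{i-1},z,d_{i+1},\dots,d_j)=d$ has at most $k$ solutions $z$ with the tuple in $U_g$; (2) under the same fixing, $z\,g(d_1,\dots,d_{i-1},z,d_{i+1},\dots,d_j)=d$ has at most $k$ solutions $z$ with the tuple in $U_g$. $E_{j,k}(n)$ is the maximum of $|U_g|$ over all $k$-regular maps $g$.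
   Formalization: The constant C is rational and the multiplicative function Υ takes rational values. -}

module Defs where

open import Data.Nat using (ℕ; _≤_; _*_; _^_)
open import Data.Nat.Divisibility using (_∣_)
open import Data.Nat.ListAction using (product)
open import Data.Sum using (_⊎_)
open import Data.Nat.Primality using (Prime)
open import Data.Nat.Coprimality using (Coprime)
open import Data.Fin using (Fin)
open import Data.Vec using (Vec; lookup; _[_]≔_)
open import Data.List using (List; length; zipWith)
open import Data.List.Relation.Unary.All using (All)
open import Data.List.Relation.Unary.Linked using (Linked)
open import Data.List.Relation.Unary.Unique.Propositional using (Unique)
open import Data.List.Membership.Propositional using (_∈_)
open import Data.Product using (Σ; _×_)
open import Data.Integer using (+_)
open import Data.Rational using (ℚ; _/_)
open import Relation.Binary.PropositionalEquality using (_≡_)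

ℕ→ℚ : ℕ → ℚ
ℕ→ℚ m = + m / 1

-- ν(n) ≡ vs : n = p₁^v₁ ⋯ p_ω^v_ω with distinct primes pᵢ and v₁ ≥ … ≥ v_ω ≥ 1.
IsNu : ℕ → List ℕ → Set
IsNu n vs = Σ (List ℕ) λ ps →
  length ps ≡ length vs × All Prime ps × Unique ps ×
  Linked (λ a b → b ≤ a) vs × All (1 ≤_) vs ×
  n ≡ product (zipWith _^_ ps vs)

DependsOnlyOnNu : (ℕ → ℚ) → Set
DependsOnlyOnNu Υ = ∀ n m vs → IsNu n vs → IsNu m vs → Υ n ≡ Υ m

Multiplicative : (ℕ → ℚ) → Set
Multiplicative Υ = Υ 1 ≡ Data.Rational.1ℚ ×
  (∀ m n → 1 ≤ m → 1 ≤ n → Coprime m n → Υ (m * n) ≡ Data.Rational._*_ (Υ m) (Υ n))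

-- U ⊆ D_n^j is regular: a finite set (duplicate-free list) of j-tuples of
-- divisors of n with pairwise coprime entries.
Regular : ℕ → (j : ℕ) → List (Vec ℕ j) → Set
Regular n j U = Unique U × All (λ t → (∀ i → lookup t i ∣ n) ×
  (∀ i i' → i ≡ i' ⊎ Coprime (lookup t i) (lookup t i'))) U

-- "the equation P z has at most k solutions z":
-- every duplicate-free list of solutions has length ≤ k.
AtMost : ℕ → (ℕ → Set) → Set
AtMost k P = ∀ (zs : List ℕ) → Unique zs → All P zs → length zs ≤ k

-- g : U → D_n is k-regular (g is given as a function on all j-tuples;
-- only its values on U matter).
KRegular : ℕ → (j : ℕ) → ℕ → List (Vec ℕ j) → (Vec ℕ j → ℕ) → Set
KRegular n j k U g =
  (∀ t → t ∈ U → g t ∣ n) ×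
  (∀ t → t ∈ U → ∀ i → Coprime (g t) (lookup t i)) ×
  (∀ (t : Vec ℕ j) (i : Fin j) (d : ℕ) →
     AtMost k (λ z → ((t [ i ]≔ z) ∈ U) × g (t [ i ]≔ z) ≡ d)) ×
  (∀ (t : Vec ℕ j) (i : Fin j) (d : ℕ) →
     AtMost k (λ z → ((t [ i ]≔ z) ∈ U) × z * g (t [ i ]≔ z) ≡ d))

-- E_{j,k}(n) ≤ b : every k-regular map g on a regular U_g ⊆ D_n^j has |U_g| ≤ b
-- (E_{j,k}(n) is the maximum of |U_g|, a maximum over a finite nonempty set).
E≤ : (j k n : ℕ) → ℚ → Set
E≤ j k n b = ∀ (U : List (Vec ℕ j)) (g : Vec ℕ j → ℕ) →
  Regular n j U → KRegular n j k U g → Data.Rational._≤_ (ℕ→ℚ (length U)) b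

-- Tensor-power trick.  Relabelling the primes of n by fresh ones gives a copy n′ of n that
-- is coprime to any given N and has ν(n′) = ν(n), hence Υ(n′) = Υ(n).  For coprime moduli
-- n₁, n₂ a k₁-regular and a k₂-regular map multiply (tuples entrywise, values of g) to a
-- k₁k₂-regular map on n₁n₂, since a solution z is determined by the pair of solutions
-- gcd(z, n₁), gcd(z, n₂) for the factors.  Multiplying copies of one k-regular map of size L
-- on n thus gives, for every m, a k^m-regular map of size L^m on some N with Υ(N) = Υ(n)^m.
-- The hypothesis yields L^m ≤ C k^m Υ(n)^m for all m, and as m grows this forces L ≤ k Υ(n).

module Submission where

open import Defs

-- ℕ's arithmetic is opened only inside this module, keeping _*_ free for ℚ in lemma3.
module _ where

  open import Data.Nat using (ℕ; zero; suc; _+_; _*_; _^_; _≤_; _<_; z≤n; s≤s; _≟_; _≤?_; _<?_; _!;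
    NonZero; >-nonZero; >-nonZero⁻¹; nonTrivial⇒≢1; nonTrivial⇒n>1)
  open import Data.Nat.Properties
  open import Data.Nat.Solver using (module +-*-Solver)
  open import Data.Nat.Induction using (<-wellFounded)
  open import Data.Nat.Divisibility
  open import Data.Nat.GCD using (gcd; gcd[m,n]∣m; gcd[m,n]∣n; gcd-greatest)
  open import Data.Nat.Coprimality as Coprime using (Coprime; coprime-divisor; prime⇒coprime)
  open import Data.Nat.Primality
    using (Prime; prime⇒nonZero; prime⇒nonTrivial; prime⇒irreducible; productOfPrimes≥1)
  open import Data.Nat.Primality.Factorisation using (PrimeFactorisation; factorise; factorisationUnique)
  open import Data.Nat.ListAction using (product)
  open import Data.Nat.ListAction.Properties using (product-++; product-↭; ∈⇒∣product)
  open import Algebra.Properties.CommutativeSemigroup *-commutativeSemigroup using (interchange)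
  open import Data.Integer as ℤ using (+_; -[1+_]; +≤+)
  import Data.Integer.Properties as ℤP
  open import Data.Rational as ℚ using (ℚ; mkℚ; toℚᵘ)
  import Data.Rational.Properties as ℚP
  open import Data.Rational.Unnormalised as ℚᵘ using (mkℚᵘ; ↥_; ↧ₙ_; *≤*)
  import Data.Rational.Unnormalised.Properties as ℚᵘP
  open import Algebra.Definitions.RawSemiring ℚ.+-*-rawSemiring using () renaming (_^_ to _^ℚ_)
  open import Algebra.Definitions.RawSemiring ℚᵘ.+-*-rawSemiring using () renaming (_^_ to _^ᵘ_)
  open import Data.List using (List; []; _∷_; _++_; length; map; filter; cartesianProduct)
  open import Data.List.Properties using (length-map; length-++; map-++; map-∘; map-id; map-cong)
  open import Data.List.Membership.Propositional using (_∈_; _∉_)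
  open import Data.List.Membership.Propositional.Properties using (∈-map⁻; ∈-cartesianProduct⁻)
  open import Data.List.Membership.DecPropositional _≟_ using (_∈?_)
  open import Data.List.Relation.Unary.Any using (here; there)
  open import Data.List.Relation.Unary.All as All using (All; []; _∷_)
  import Data.List.Relation.Unary.All.Properties as All
  open import Data.List.Relation.Unary.AllPairs using ([]; _∷_)
  open import Data.List.Relation.Unary.Linked using ([-])
  open import Data.List.Relation.Unary.Unique.Propositional using (Unique)
  import Data.List.Relation.Unary.Unique.Propositional.Properties as Unique
  import Data.List.Relation.Binary.Permutation.Propositional.Properties as Perm
  open import Data.Fin using (Fin)
  open import Data.Vec as Vec using (Vec; lookup; _[_]≔_)
  open import Data.Vec.Properties using (lookup-map; lookup-zipWith; map-[]≔; lookup∘update)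
    renaming (map-∘ to Vec-map-∘; map-id to Vec-map-id; map-cong to Vec-map-cong)
  open import Data.Vec.Relation.Binary.Pointwise.Extensional using (ext; Pointwise-≡⇒≡)
  open import Data.Bool using (true; false)
  open import Data.Empty using (⊥-elim)
  open import Data.Product using (Σ; ∃₂; _×_; _,_; proj₁; proj₂; uncurry)
  open import Data.Sum using (_⊎_; inj₁; inj₂)
  open import Function using (_∘_; _⇔_; mk⇔; Equivalence)
  open import Induction.WellFounded using (Acc; acc)
  open import Level using (0ℓ)
  open import Relation.Nullary using (¬_; does; yes; no)
  open import Relation.Unary using (Pred; Decidable)
  open import Relation.Unary.Properties using (∁?)
  open import Relation.Binary.PropositionalEquality

  private
    variable
      a b c d m n p x : ℕ

  coprime-∣ˡ : Coprime m n → d ∣ m → Coprime d n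
  coprime-∣ˡ c d∣m (e∣d , e∣n) = c (∣-trans e∣d d∣m , e∣n)

  coprime-∣ : Coprime m n → a ∣ m → b ∣ n → Coprime a b
  coprime-∣ c a∣m b∣n = Coprime.sym (coprime-∣ˡ (Coprime.sym (coprime-∣ˡ c a∣m)) b∣n)

  coprime-*ʳ : Coprime m a → Coprime m b → Coprime m (a * b)
  coprime-*ʳ ca cb (d∣m , d∣ab) = cb (d∣m , coprime-divisor (coprime-∣ˡ ca d∣m) d∣ab)

  coprime-*ˡ : Coprime a m → Coprime b m → Coprime (a * b) m
  coprime-*ˡ ca cb = Coprime.sym (coprime-*ʳ (Coprime.sym ca) (Coprime.sym cb))

  coprime-*-* : Coprime a c → Coprime a d → Coprime b c → Coprime b d → Coprime (a * b) (c * d)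
  coprime-*-* a⊥c a⊥d b⊥c b⊥d = coprime-*ˡ (coprime-*ʳ a⊥c a⊥d) (coprime-*ʳ b⊥c b⊥d)

  coprime⇒*∣ : Coprime a b → a ∣ n → b ∣ n → a * b ∣ n
  coprime⇒*∣ {a} {b} a⊥b (divides q n≡q*a) b∣n =
    subst (a * b ∣_) (sym n≡q*a) (subst (_∣ q * a) (*-comm b a) (*-monoˡ-∣ a b∣q))
    where
    b∣q : b ∣ q
    b∣q = coprime-divisor (Coprime.sym a⊥b) (subst (b ∣_) (trans n≡q*a (*-comm q a)) b∣n)

  gcd[a*b,m]≡a : Coprime m n → a ∣ m → b ∣ n → gcd (a * b) m ≡ a
  gcd[a*b,m]≡a {m} {n} {a} {b} m⊥n a∣m b∣n = ∣-antisym g∣a (gcd-greatest (m∣m*n b) a∣m)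
    where
    g∣a : gcd (a * b) m ∣ a
    g∣a = coprime-divisor (coprime-∣ m⊥n (gcd[m,n]∣n (a * b) m) b∣n)
            (subst (gcd (a * b) m ∣_) (*-comm a b) (gcd[m,n]∣m (a * b) m))

  gcd[a*b,n]≡b : Coprime m n → a ∣ m → b ∣ n → gcd (a * b) n ≡ b
  gcd[a*b,n]≡b {n = n} {a} {b} m⊥n a∣m b∣n =
    trans (cong (λ x → gcd x n) (*-comm a b)) (gcd[a*b,m]≡a (Coprime.sym m⊥n) b∣n a∣m)

  module _ {A : Set} {P : Pred A 0ℓ} (P? : Decidable P) where

    length-filter+filter∁ : ∀ xs → length (filter P? xs) + length (filter (∁? P?) xs) ≡ length xs
    length-filter+filter∁ [] = refl
    length-filter+filter∁ (x ∷ xs) with does (P? x)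
    ... | true  = cong suc (length-filter+filter∁ xs)
    ... | false = trans (+-suc _ _) (cong suc (length-filter+filter∁ xs))

  map⁺-injectiveOn : ∀ {A B : Set} {f : A → B} {Q : Pred A 0ℓ} →
    (∀ {x y} → Q x → Q y → f x ≡ f y → x ≡ y) →
    ∀ {xs} → All Q xs → Unique xs → Unique (map f xs)
  map⁺-injectiveOn inj [] [] = []
  map⁺-injectiveOn inj (qx ∷ qxs) (x∉xs ∷ u) =
    All.map⁺ (All.zipWith (λ (x≢y , qy) fx≡fy → x≢y (inj qx qy fx≡fy)) (x∉xs , qxs))
    ∷ map⁺-injectiveOn inj qxs u

  length-cartesianProduct : ∀ {A B : Set} (xs : List A) (ys : List B) →
    length (cartesianProduct xs ys) ≡ length xs * length ys
  length-cartesianProduct [] ys = refl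
  length-cartesianProduct (x ∷ xs) ys = trans (length-++ (map (x ,_) ys))
    (cong₂ _+_ (length-map (x ,_) ys) (length-cartesianProduct xs ys))

  -- The solutions with the same f₁-value as a fixed one are at most k₂, since f₂ is injective on
  -- them; the others solve a system in which P₁ has lost a solution.
  AtMost-* : ∀ {k₁ k₂} {P₁ P₂ Q : ℕ → Set} (f₁ f₂ : ℕ → ℕ) → AtMost k₁ P₁ → AtMost k₂ P₂ →
    (∀ {z} → Q z → P₁ (f₁ z) × P₂ (f₂ z)) →
    (∀ {z z′} → Q z → Q z′ → f₁ z ≡ f₁ z′ → f₂ z ≡ f₂ z′ → z ≡ z′) →
    AtMost (k₁ * k₂) Q
  AtMost-* f₁ f₂ at₁ at₂ sol inj [] _ _ = z≤n
  AtMost-* {zero} f₁ f₂ at₁ at₂ sol inj (z ∷ _) _ (qz ∷ _) =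
    ⊥-elim (1+n≰n (at₁ (f₁ z ∷ []) ([] ∷ []) (proj₁ (sol qz) ∷ [])))
  AtMost-* {suc k₁} {k₂} {P₁} f₁ f₂ at₁ at₂ sol inj zs@(z ∷ _) u qs@(qz ∷ _) = begin
    length zs                    ≡⟨ length-filter+filter∁ inFibre zs ⟨
    length fibre + length others ≤⟨ +-mono-≤ fibre-bound others-bound ⟩
    k₂ + k₁ * k₂                 ∎
    where
    open ≤-Reasoning
    y = f₁ z
    inFibre : Decidable (λ w → f₁ w ≡ y)
    inFibre w = f₁ w ≟ y
    fibre = filter inFibre zs
    others = filter (∁? inFibre) zs

    fibre-bound : length fibre ≤ k₂
    fibre-bound = subst (_≤ k₂) (length-map f₂ fibre)
      (at₂ (map f₂ fibre)
        (map⁺-injectiveOn (λ (e , q) (e′ , q′) → inj q q′ (trans e (sym e′)))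
          fibre-sols (Unique.filter⁺ inFibre u))
        (All.map⁺ (All.map (proj₂ ∘ sol ∘ proj₂) fibre-sols)))
      where
      fibre-sols = All.zip (All.all-filter inFibre zs , All.filter⁺ inFibre qs)

    at₁-others : AtMost k₁ (λ x → P₁ x × x ≢ y)
    at₁-others xs u′ pxs = ≤-pred (at₁ (y ∷ xs)
      (All.map (λ (_ , x≢y) y≡x → x≢y (sym y≡x)) pxs ∷ u′) (proj₁ (sol qz) ∷ All.map proj₁ pxs))

    others-bound : length others ≤ k₁ * k₂
    others-bound = AtMost-* f₁ f₂ at₁-others at₂
      (λ (f₁w≢y , qw) → (proj₁ (sol qw) , f₁w≢y) , proj₂ (sol qw)) (λ (_ , q) (_ , q′) → inj q q′)
      others (Unique.filter⁺ (∁? inFibre) u)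
      (All.zip (All.all-filter (∁? inFibre) zs , All.filter⁺ (∁? inFibre) qs))

  -- k-regular maps and their products

  -- Conditions (1) and (2) of k-regularity count the z with lhs eq₁ z (g t′) ≡ d, resp.
  -- lhs eq₂ z (g t′) ≡ d, where t′ = t [ i ]≔ z.
  data Equation : Set where
    eq₁ eq₂ : Equation

  lhs : Equation → ℕ → ℕ → ℕ
  lhs eq₁ z x = x
  lhs eq₂ z x = z * x

  lhs-* : ∀ e z₁ z₂ x₁ x₂ → lhs e (z₁ * z₂) (x₁ * x₂) ≡ lhs e z₁ x₁ * lhs e z₂ x₂
  lhs-* eq₁ z₁ z₂ x₁ x₂ = refl
  lhs-* eq₂ z₁ z₂ x₁ x₂ = interchange z₁ z₂ x₁ x₂

  Solutions : ∀ {j} → List (Vec ℕ j) → (Vec ℕ j → ℕ) → Equation → Vec ℕ j → Fin j → ℕ → ℕ → Set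
  Solutions U g e t i d z = (t [ i ]≔ z) ∈ U × lhs e z (g (t [ i ]≔ z)) ≡ d

  record KRegularMap (j k n : ℕ) : Set where
    field
      U : List (Vec ℕ j)
      g : Vec ℕ j → ℕ
      regular : Regular n j U
      kRegular : KRegular n j k U g

    size : ℕ
    size = length U

    entry∣n : ∀ {t} → t ∈ U → ∀ i → lookup t i ∣ n
    entry∣n t∈U = proj₁ (All.lookup (proj₂ regular) t∈U)

    entries-coprime : ∀ {t} → t ∈ U → ∀ i i′ → i ≡ i′ ⊎ Coprime (lookup t i) (lookup t i′)
    entries-coprime t∈U = proj₂ (All.lookup (proj₂ regular) t∈U)

    g∣n : ∀ {t} → t ∈ U → g t ∣ n
    g∣n = proj₁ kRegular _

    g-coprime : ∀ {t} → t ∈ U → ∀ i → Coprime (g t) (lookup t i)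
    g-coprime = proj₁ (proj₂ kRegular) _

    few-solutions : ∀ e t i d → AtMost k (Solutions U g e t i d)
    few-solutions eq₁ = proj₁ (proj₂ (proj₂ kRegular))
    few-solutions eq₂ = proj₂ (proj₂ (proj₂ kRegular))

    lhs∣n : ∀ e {t} → t ∈ U → ∀ i → lhs e (lookup t i) (g t) ∣ n
    lhs∣n eq₁ t∈U i = g∣n t∈U
    lhs∣n eq₂ t∈U i = coprime⇒*∣ (Coprime.sym (g-coprime t∈U i)) (entry∣n t∈U i) (g∣n t∈U)

  mkKRegular : ∀ {j k n U g} → (∀ {t} → t ∈ U → g t ∣ n) →
    (∀ {t} → t ∈ U → ∀ i → Coprime (g t) (lookup t i)) →
    (∀ e t i d → AtMost k (Solutions U g e t i d)) → KRegular n j k U g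
  mkKRegular g∣n g-coprime few = (λ _ → g∣n) , (λ _ → g-coprime) , few eq₁ , few eq₂

  infixl 7 _⊙_
  _⊙_ : ∀ {j} → Vec ℕ j → Vec ℕ j → Vec ℕ j
  _⊙_ = Vec.zipWith _*_

  part : ∀ {j} → ℕ → Vec ℕ j → Vec ℕ j
  part m = Vec.map (λ x → gcd x m)

  part-[]≔ : ∀ {j} m (t : Vec ℕ j) i z → part m (t [ i ]≔ z) ≡ part m t [ i ]≔ gcd z m
  part-[]≔ m t i z = map-[]≔ (λ x → gcd x m) t i

  module _ {j} {a b : Vec ℕ j} (m⊥n : Coprime m n)
           (a∣m : ∀ i → lookup a i ∣ m) (b∣n : ∀ i → lookup b i ∣ n) where

    part-⊙ˡ : part m (a ⊙ b) ≡ a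
    part-⊙ˡ = Pointwise-≡⇒≡ (ext λ i → trans (lookup-map i _ (a ⊙ b))
      (trans (cong (λ x → gcd x m) (lookup-zipWith _*_ i a b)) (gcd[a*b,m]≡a m⊥n (a∣m i) (b∣n i))))

    part-⊙ʳ : part n (a ⊙ b) ≡ b
    part-⊙ʳ = Pointwise-≡⇒≡ (ext λ i → trans (lookup-map i _ (a ⊙ b))
      (trans (cong (λ x → gcd x n) (lookup-zipWith _*_ i a b)) (gcd[a*b,n]≡b m⊥n (a∣m i) (b∣n i))))

  module Product {j k₁ k₂ n₁ n₂} (n₁⊥n₂ : Coprime n₁ n₂)
                 (G₁ : KRegularMap j k₁ n₁) (G₂ : KRegularMap j k₂ n₂) where
    private
      module G₁ = KRegularMap G₁
      module G₂ = KRegularMap G₂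

    U : List (Vec ℕ j)
    U = map (uncurry _⊙_) (cartesianProduct G₁.U G₂.U)

    g : Vec ℕ j → ℕ
    g t = G₁.g (part n₁ t) * G₂.g (part n₂ t)

    module _ {a b} (a∈U₁ : a ∈ G₁.U) (b∈U₂ : b ∈ G₂.U) where

      part₁ : part n₁ (a ⊙ b) ≡ a
      part₁ = part-⊙ˡ n₁⊥n₂ (G₁.entry∣n a∈U₁) (G₂.entry∣n b∈U₂)

      part₂ : part n₂ (a ⊙ b) ≡ b
      part₂ = part-⊙ʳ n₁⊥n₂ (G₁.entry∣n a∈U₁) (G₂.entry∣n b∈U₂)

      g-⊙ : g (a ⊙ b) ≡ G₁.g a * G₂.g b
      g-⊙ = cong₂ _*_ (cong G₁.g part₁) (cong G₂.g part₂)

    solution-part : ∀ {k m} (G : KRegularMap j k m) (let module G = KRegularMap G) {e t i d z a} →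
      a ∈ G.U → part m (t [ i ]≔ z) ≡ a → gcd z m ≡ lookup a i → gcd d m ≡ lhs e (lookup a i) (G.g a) →
      Solutions G.U G.g e (part m t) i (gcd d m) (gcd z m)
    solution-part {m = m} G {e} {t} {i} {d} {z} a∈U part≡a z≡aᵢ d≡lhs =
      subst (_∈ G.U) (sym t≡a) a∈U , trans (cong₂ (lhs e) z≡aᵢ (cong G.g t≡a)) (sym d≡lhs)
      where
      module G = KRegularMap G
      t≡a = trans (sym (part-[]≔ m t i z)) part≡a

    ∈-U⁻ : ∀ {t} → t ∈ U → ∃₂ λ a b → a ∈ G₁.U × b ∈ G₂.U × t ≡ a ⊙ b
    ∈-U⁻ t∈U with ∈-map⁻ (uncurry _⊙_) t∈U
    ... | (a , b) , ab∈ , t≡a⊙b = a , b , proj₁ (∈-cartesianProduct⁻ G₁.U G₂.U ab∈) ,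
                                  proj₂ (∈-cartesianProduct⁻ G₁.U G₂.U ab∈) , t≡a⊙b

    size≡ : length U ≡ G₁.size * G₂.size
    size≡ = trans (length-map _ (cartesianProduct G₁.U G₂.U)) (length-cartesianProduct G₁.U G₂.U)

    unique : Unique U
    unique = map⁺-injectiveOn
      (λ {(a , b)} {(a′ , b′)} (a∈ , b∈) (a′∈ , b′∈) eq →
        cong₂ _,_ (trans (sym (part₁ a∈ b∈)) (trans (cong (part n₁) eq) (part₁ a′∈ b′∈)))
                  (trans (sym (part₂ a∈ b∈)) (trans (cong (part n₂) eq) (part₂ a′∈ b′∈))))
      (All.tabulate (∈-cartesianProduct⁻ G₁.U G₂.U))
      (Unique.cartesianProduct⁺ (proj₁ G₁.regular) (proj₁ G₂.regular))

    regular : Regular (n₁ * n₂) j U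
    regular = unique , All.tabulate regular-entries
      where
      regular-entries : ∀ {t} → t ∈ U → (∀ i → lookup t i ∣ n₁ * n₂) ×
                        (∀ i i′ → i ≡ i′ ⊎ Coprime (lookup t i) (lookup t i′))
      regular-entries t∈U with ∈-U⁻ t∈U
      ... | a , b , a∈ , b∈ , refl = entry∣n₁n₂ , entries-coprime
        where
        entryᵢ : ∀ i → lookup (a ⊙ b) i ≡ lookup a i * lookup b i
        entryᵢ i = lookup-zipWith _*_ i a b
        entry∣n₁n₂ : ∀ i → lookup (a ⊙ b) i ∣ n₁ * n₂
        entry∣n₁n₂ i = subst (_∣ n₁ * n₂) (sym (entryᵢ i))
          (*-pres-∣ (G₁.entry∣n a∈ i) (G₂.entry∣n b∈ i))
        entries-coprime : ∀ i i′ → i ≡ i′ ⊎ Coprime (lookup (a ⊙ b) i) (lookup (a ⊙ b) i′)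
        entries-coprime i i′ with G₁.entries-coprime a∈ i i′ | G₂.entries-coprime b∈ i i′
        ... | inj₁ i≡i′ | _ = inj₁ i≡i′
        ... | inj₂ _ | inj₁ i≡i′ = inj₁ i≡i′
        ... | inj₂ aᵢ⊥aᵢ′ | inj₂ bᵢ⊥bᵢ′ = inj₂ (subst₂ Coprime (sym (entryᵢ i)) (sym (entryᵢ i′))
          (coprime-*-* aᵢ⊥aᵢ′ (coprime-∣ n₁⊥n₂ (G₁.entry∣n a∈ i) (G₂.entry∣n b∈ i′))
                       (coprime-∣ (Coprime.sym n₁⊥n₂) (G₂.entry∣n b∈ i) (G₁.entry∣n a∈ i′)) bᵢ⊥bᵢ′))

    g∣n₁n₂ : ∀ {t} → t ∈ U → g t ∣ n₁ * n₂
    g∣n₁n₂ t∈U with ∈-U⁻ t∈U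
    ... | a , b , a∈ , b∈ , refl =
      subst (_∣ n₁ * n₂) (sym (g-⊙ a∈ b∈)) (*-pres-∣ (G₁.g∣n a∈) (G₂.g∣n b∈))

    g-coprime : ∀ {t} → t ∈ U → ∀ i → Coprime (g t) (lookup t i)
    g-coprime t∈U i with ∈-U⁻ t∈U
    ... | a , b , a∈ , b∈ , refl = subst₂ Coprime (sym (g-⊙ a∈ b∈)) (sym (lookup-zipWith _*_ i a b))
      (coprime-*-* (G₁.g-coprime a∈ i) (coprime-∣ n₁⊥n₂ (G₁.g∣n a∈) (G₂.entry∣n b∈ i))
                   (coprime-∣ (Coprime.sym n₁⊥n₂) (G₂.g∣n b∈) (G₁.entry∣n a∈ i)) (G₂.g-coprime b∈ i))

    few-solutions : ∀ e t i d → AtMost (k₁ * k₂) (Solutions U g e t i d)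
    few-solutions e t i d = AtMost-* (λ z → gcd z n₁) (λ z → gcd z n₂)
      (G₁.few-solutions e (part n₁ t) i (gcd d n₁)) (G₂.few-solutions e (part n₂ t) i (gcd d n₂))
      (λ sol → proj₁ (split sol)) (λ sol sol′ z₁≡ z₂≡ →
        trans (proj₂ (split sol)) (trans (cong₂ _*_ z₁≡ z₂≡) (sym (proj₂ (split sol′)))))
      where
      split : ∀ {z} → Solutions U g e t i d z →
        (Solutions G₁.U G₁.g e (part n₁ t) i (gcd d n₁) (gcd z n₁) ×
         Solutions G₂.U G₂.g e (part n₂ t) i (gcd d n₂) (gcd z n₂)) × z ≡ gcd z n₁ * gcd z n₂
      split {z} (t′∈U , lhs≡d) with ∈-U⁻ t′∈U
      ... | a , b , a∈ , b∈ , t′≡a⊙b =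
        (solution-part G₁ {e} {t} {i} {d} {z} a∈
           (trans (cong (part n₁) t′≡a⊙b) (part₁ a∈ b∈)) z₁≡aᵢ d₁≡ ,
         solution-part G₂ {e} {t} {i} {d} {z} b∈
           (trans (cong (part n₂) t′≡a⊙b) (part₂ a∈ b∈)) z₂≡bᵢ d₂≡) ,
        trans z≡aᵢbᵢ (sym (cong₂ _*_ z₁≡aᵢ z₂≡bᵢ))
        where
        z≡aᵢbᵢ : z ≡ lookup a i * lookup b i
        z≡aᵢbᵢ = trans (sym (lookup∘update i t z))
          (trans (cong (λ v → lookup v i) t′≡a⊙b) (lookup-zipWith _*_ i a b))
        z₁≡aᵢ : gcd z n₁ ≡ lookup a i
        z₁≡aᵢ = trans (cong (λ x → gcd x n₁) z≡aᵢbᵢ)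
          (gcd[a*b,m]≡a n₁⊥n₂ (G₁.entry∣n a∈ i) (G₂.entry∣n b∈ i))
        z₂≡bᵢ : gcd z n₂ ≡ lookup b i
        z₂≡bᵢ = trans (cong (λ x → gcd x n₂) z≡aᵢbᵢ)
          (gcd[a*b,n]≡b n₁⊥n₂ (G₁.entry∣n a∈ i) (G₂.entry∣n b∈ i))
        d≡ : d ≡ lhs e (lookup a i) (G₁.g a) * lhs e (lookup b i) (G₂.g b)
        d≡ = trans (sym lhs≡d) (trans (cong₂ (lhs e) z≡aᵢbᵢ (trans (cong g t′≡a⊙b) (g-⊙ a∈ b∈)))
                                      (lhs-* e _ _ _ _))
        d₁≡ : gcd d n₁ ≡ lhs e (lookup a i) (G₁.g a)
        d₁≡ = trans (cong (λ x → gcd x n₁) d≡)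
          (gcd[a*b,m]≡a n₁⊥n₂ (G₁.lhs∣n e a∈ i) (G₂.lhs∣n e b∈ i))
        d₂≡ : gcd d n₂ ≡ lhs e (lookup b i) (G₂.g b)
        d₂≡ = trans (cong (λ x → gcd x n₂) d≡)
          (gcd[a*b,n]≡b n₁⊥n₂ (G₁.lhs∣n e a∈ i) (G₂.lhs∣n e b∈ i))

    kRegularMap : KRegularMap j (k₁ * k₂) (n₁ * n₂)
    kRegularMap = record
      { U = U ; g = g ; regular = regular ; kRegular = mkKRegular g∣n₁n₂ g-coprime few-solutions }

  -- Relabelling primes

  record Relabelling : Set where
    field
      τ τ⁻¹ : ℕ → ℕ
      τ⁻¹∘τ : ∀ x → τ⁻¹ (τ x) ≡ x
      τ∘τ⁻¹ : ∀ x → τ (τ⁻¹ x) ≡ x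
      τ-* : ∀ a b → τ (a * b) ≡ τ a * τ b
      τ-0 : τ 0 ≡ 0
      τ-1 : τ 1 ≡ 1
      τ-prime : ∀ {p} → Prime p → Prime (τ p)

    τ-injective : τ a ≡ τ b → a ≡ b
    τ-injective {a} {b} τa≡τb = trans (sym (τ⁻¹∘τ a)) (trans (cong τ⁻¹ τa≡τb) (τ⁻¹∘τ b))

    τ⁻¹-injective : τ⁻¹ a ≡ τ⁻¹ b → a ≡ b
    τ⁻¹-injective {a} {b} τ⁻¹a≡τ⁻¹b =
      trans (sym (τ∘τ⁻¹ a)) (trans (cong τ τ⁻¹a≡τ⁻¹b) (τ∘τ⁻¹ b))

    τ⁻¹-* : ∀ a b → τ⁻¹ (a * b) ≡ τ⁻¹ a * τ⁻¹ b
    τ⁻¹-* a b = τ-injective (trans (τ∘τ⁻¹ (a * b))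
      (sym (trans (τ-* (τ⁻¹ a) (τ⁻¹ b)) (cong₂ _*_ (τ∘τ⁻¹ a) (τ∘τ⁻¹ b)))))

    τ⁻¹-lhs : ∀ e z x → τ⁻¹ (lhs e z x) ≡ lhs e (τ⁻¹ z) (τ⁻¹ x)
    τ⁻¹-lhs eq₁ z x = refl
    τ⁻¹-lhs eq₂ z x = τ⁻¹-* z x

    τ-∣ : a ∣ b → τ a ∣ τ b
    τ-∣ {a} (divides q b≡q*a) = divides (τ q) (trans (cong τ b≡q*a) (τ-* q a))

    τ⁻¹-∣ : a ∣ b → τ⁻¹ a ∣ τ⁻¹ b
    τ⁻¹-∣ {a} (divides q b≡q*a) = divides (τ⁻¹ q) (trans (cong τ⁻¹ b≡q*a) (τ⁻¹-* q a))

    τ-coprime : Coprime a b → Coprime (τ a) (τ b)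
    τ-coprime {a} {b} a⊥b {d} (d∣τa , d∣τb) = trans (sym (τ∘τ⁻¹ d)) (trans (cong τ (a⊥b
      (subst (τ⁻¹ d ∣_) (τ⁻¹∘τ a) (τ⁻¹-∣ d∣τa) , subst (τ⁻¹ d ∣_) (τ⁻¹∘τ b) (τ⁻¹-∣ d∣τb)))) τ-1)

    τ-positive : 1 ≤ a → 1 ≤ τ a
    τ-positive {a} 1≤a with τ a in τa≡
    ... | zero = ⊥-elim (<⇒≢ 1≤a (sym (τ-injective (trans τa≡ (sym τ-0)))))
    ... | suc _ = s≤s z≤n

    τ-^ : ∀ p v → τ (p ^ v) ≡ τ p ^ v
    τ-^ p zero = τ-1
    τ-^ p (suc v) = trans (τ-* p (p ^ v)) (cong (τ p *_) (τ-^ p v))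

  module Relabel (ρ : Relabelling) {j k n} (G : KRegularMap j k n) where
    open Relabelling ρ
    private
      module G = KRegularMap G

    τᵛ τ⁻¹ᵛ : Vec ℕ j → Vec ℕ j
    τᵛ = Vec.map τ
    τ⁻¹ᵛ = Vec.map τ⁻¹

    τ⁻¹ᵛ∘τᵛ : ∀ t → τ⁻¹ᵛ (τᵛ t) ≡ t
    τ⁻¹ᵛ∘τᵛ t = trans (sym (Vec-map-∘ τ⁻¹ τ t)) (trans (Vec-map-cong τ⁻¹∘τ t) (Vec-map-id t))

    U : List (Vec ℕ j)
    U = map τᵛ G.U

    g : Vec ℕ j → ℕ
    g t = τ (G.g (τ⁻¹ᵛ t))

    size≡ : length U ≡ G.size
    size≡ = length-map τᵛ G.U

    ∈-U⁻ : ∀ {t} → t ∈ U → Σ (Vec ℕ j) λ s → s ∈ G.U × t ≡ τᵛ s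
    ∈-U⁻ = ∈-map⁻ τᵛ

    g-τᵛ : ∀ s → g (τᵛ s) ≡ τ (G.g s)
    g-τᵛ s = cong (τ ∘ G.g) (τ⁻¹ᵛ∘τᵛ s)

    τ⁻¹ᵛ-∈ : ∀ {t} → t ∈ U → τ⁻¹ᵛ t ∈ G.U
    τ⁻¹ᵛ-∈ t∈U with ∈-U⁻ t∈U
    ... | s , s∈ , refl = subst (_∈ G.U) (sym (τ⁻¹ᵛ∘τᵛ s)) s∈

    regular : Regular (τ n) j U
    regular = Unique.map⁺ τᵛ-injective (proj₁ G.regular) , All.tabulate regular-entries
      where
      τᵛ-injective : ∀ {s s′} → τᵛ s ≡ τᵛ s′ → s ≡ s′
      τᵛ-injective {s} {s′} τs≡τs′ = trans (sym (τ⁻¹ᵛ∘τᵛ s)) (trans (cong τ⁻¹ᵛ τs≡τs′) (τ⁻¹ᵛ∘τᵛ s′))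
      regular-entries : ∀ {t} → t ∈ U → (∀ i → lookup t i ∣ τ n) ×
                        (∀ i i′ → i ≡ i′ ⊎ Coprime (lookup t i) (lookup t i′))
      regular-entries t∈U with ∈-U⁻ t∈U
      ... | s , s∈ , refl = entry∣τn , entries-coprime
        where
        entry∣τn : ∀ i → lookup (τᵛ s) i ∣ τ n
        entry∣τn i = subst (_∣ τ n) (sym (lookup-map i τ s)) (τ-∣ (G.entry∣n s∈ i))
        entries-coprime : ∀ i i′ → i ≡ i′ ⊎ Coprime (lookup (τᵛ s) i) (lookup (τᵛ s) i′)
        entries-coprime i i′ with G.entries-coprime s∈ i i′
        ... | inj₁ i≡i′ = inj₁ i≡i′
        ... | inj₂ sᵢ⊥sᵢ′ = inj₂ (subst₂ Coprime (sym (lookup-map i τ s)) (sym (lookup-map i′ τ s))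
                                        (τ-coprime sᵢ⊥sᵢ′))

    g∣τn : ∀ {t} → t ∈ U → g t ∣ τ n
    g∣τn t∈U with ∈-U⁻ t∈U
    ... | s , s∈ , refl = subst (_∣ τ n) (sym (g-τᵛ s)) (τ-∣ (G.g∣n s∈))

    g-coprime : ∀ {t} → t ∈ U → ∀ i → Coprime (g t) (lookup t i)
    g-coprime t∈U i with ∈-U⁻ t∈U
    ... | s , s∈ , refl =
      subst₂ Coprime (sym (g-τᵛ s)) (sym (lookup-map i τ s)) (τ-coprime (G.g-coprime s∈ i))

    few-solutions : ∀ e t i d → AtMost k (Solutions U g e t i d)
    few-solutions e t i d zs u sols = subst (_≤ k) (length-map τ⁻¹ zs)
      (G.few-solutions e (τ⁻¹ᵛ t) i (τ⁻¹ d) (map τ⁻¹ zs)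
        (Unique.map⁺ τ⁻¹-injective u) (All.map⁺ (All.map pull sols)))
      where
      pull : ∀ {z} → Solutions U g e t i d z → Solutions G.U G.g e (τ⁻¹ᵛ t) i (τ⁻¹ d) (τ⁻¹ z)
      pull {z} (t′∈U , lhs≡d) = subst (_∈ G.U) τ⁻¹ᵛt′≡ (τ⁻¹ᵛ-∈ t′∈U) , (begin
        lhs e (τ⁻¹ z) (G.g (τ⁻¹ᵛ t [ i ]≔ τ⁻¹ z)) ≡⟨ cong (lhs e (τ⁻¹ z) ∘ G.g) τ⁻¹ᵛt′≡ ⟨
        lhs e (τ⁻¹ z) (G.g (τ⁻¹ᵛ (t [ i ]≔ z)))   ≡⟨ cong (lhs e (τ⁻¹ z)) (τ⁻¹∘τ _) ⟨
        lhs e (τ⁻¹ z) (τ⁻¹ (g (t [ i ]≔ z)))      ≡⟨ τ⁻¹-lhs e z _ ⟨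
        τ⁻¹ (lhs e z (g (t [ i ]≔ z)))             ≡⟨ cong τ⁻¹ lhs≡d ⟩
        τ⁻¹ d                                      ∎)
        where
        open ≡-Reasoning
        τ⁻¹ᵛt′≡ : τ⁻¹ᵛ (t [ i ]≔ z) ≡ τ⁻¹ᵛ t [ i ]≔ τ⁻¹ z
        τ⁻¹ᵛt′≡ = map-[]≔ τ⁻¹ t i

    kRegularMap : KRegularMap j k (τ n)
    kRegularMap = record { U = U ; g = g ; regular = regular ; kRegular = mkKRegular g∣τn g-coprime few-solutions }

  transpose : ℕ → ℕ → ℕ → ℕ
  transpose a b x with x ≟ a | x ≟ b
  ... | yes _ | _     = b
  ... | no _  | yes _ = a
  ... | no _  | no _  = x

  transpose-a : ∀ a b → transpose a b a ≡ b
  transpose-a a b with a ≟ a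
  ... | yes _ = refl
  ... | no a≢a = ⊥-elim (a≢a refl)

  transpose-b : ∀ a b → transpose a b b ≡ a
  transpose-b a b with b ≟ a | b ≟ b
  ... | yes b≡a | _ = b≡a
  ... | no _ | yes _ = refl
  ... | no _ | no b≢b = ⊥-elim (b≢b refl)

  transpose-other : ∀ {a b x} → x ≢ a → x ≢ b → transpose a b x ≡ x
  transpose-other {a} {b} {x} x≢a x≢b with x ≟ a | x ≟ b
  ... | yes x≡a | _ = ⊥-elim (x≢a x≡a)
  ... | no _ | yes x≡b = ⊥-elim (x≢b x≡b)
  ... | no _ | no _ = refl

  transpose-involutive : ∀ a b x → transpose a b (transpose a b x) ≡ x
  transpose-involutive a b x with x ≟ a | x ≟ b
  ... | yes refl | _ = transpose-b a b
  ... | no _ | yes refl = transpose-a a b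
  ... | no x≢a | no x≢b = transpose-other x≢a x≢b

  transpose-prime : Prime a → Prime b → Prime x → Prime (transpose a b x)
  transpose-prime {a} {b} {x} pa pb px with x ≟ a | x ≟ b
  ... | yes _ | _ = pb
  ... | no _ | yes _ = pa
  ... | no _ | no _ = px

  permute unpermute : List (ℕ × ℕ) → ℕ → ℕ
  permute [] x = x
  permute ((a , b) ∷ l) x = transpose a b (permute l x)
  unpermute [] x = x
  unpermute ((a , b) ∷ l) x = unpermute l (transpose a b x)

  unpermute∘permute : ∀ l x → unpermute l (permute l x) ≡ x
  unpermute∘permute [] x = refl
  unpermute∘permute ((a , b) ∷ l) x =
    trans (cong (unpermute l) (transpose-involutive a b (permute l x))) (unpermute∘permute l x)

  permute∘unpermute : ∀ l x → permute l (unpermute l x) ≡ x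
  permute∘unpermute [] x = refl
  permute∘unpermute ((a , b) ∷ l) x =
    trans (cong (transpose a b) (permute∘unpermute l (transpose a b x))) (transpose-involutive a b x)

  PrimePairs : List (ℕ × ℕ) → Set
  PrimePairs = All (λ (a , b) → Prime a × Prime b)

  permute-prime : ∀ {l} → PrimePairs l → Prime x → Prime (permute l x)
  permute-prime [] px = px
  permute-prime ((pa , pb) ∷ ps) px = transpose-prime pa pb (permute-prime ps px)

  unpermute-prime : ∀ {l} → PrimePairs l → Prime x → Prime (unpermute l x)
  unpermute-prime [] px = px
  unpermute-prime ((pa , pb) ∷ ps) px = unpermute-prime ps (transpose-prime pa pb px)

  factors : ∀ n → .{{NonZero n}} → List ℕ
  factors n = PrimeFactorisation.factors (factorise n)

  factors-prime : ∀ n → .{{_ : NonZero n}} → All Prime (factors n)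
  factors-prime n = PrimeFactorisation.factorsPrime (factorise n)

  product-factors : ∀ n → .{{_ : NonZero n}} → n ≡ product (factors n)
  product-factors n = PrimeFactorisation.isFactorisation (factorise n)

  extend : (ℕ → ℕ) → ℕ → ℕ
  extend f zero = zero
  extend f n@(suc _) = product (map f (factors n))

  extend-product : ∀ f {n ps} → All Prime ps → n ≡ product ps → extend f n ≡ product (map f ps)
  extend-product f {n} {ps} ps-prime n≡Πps with n
  ... | zero = ⊥-elim (<⇒≢ (productOfPrimes≥1 ps-prime) n≡Πps)
  ... | suc n′ = product-↭ (Perm.map⁺ f (factorisationUnique (factorise (suc n′))
    (record { factors = ps ; isFactorisation = n≡Πps ; factorsPrime = ps-prime })))

  extend-* : ∀ f a b → extend f (a * b) ≡ extend f a * extend f b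
  extend-* f zero b = refl
  extend-* f a@(suc _) zero = trans (cong (extend f) (*-zeroʳ a)) (sym (*-zeroʳ (extend f a)))
  extend-* f a@(suc _) b@(suc _) = begin
    extend f (a * b)
      ≡⟨ extend-product f (All.++⁺ (factors-prime a) (factors-prime b)) Πab ⟩
    product (map f (factors a ++ factors b))         ≡⟨ cong product (map-++ f (factors a) (factors b)) ⟩
    product (map f (factors a) ++ map f (factors b)) ≡⟨ product-++ (map f (factors a)) (map f (factors b)) ⟩
    extend f a * extend f b                          ∎
    where
    open ≡-Reasoning
    Πab : a * b ≡ product (factors a ++ factors b)
    Πab = trans (cong₂ _*_ (product-factors a) (product-factors b)) (sym (product-++ (factors a) (factors b)))

  extend-prime : ∀ f → Prime p → extend f p ≡ f p
  extend-prime {p} f p-prime =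
    trans (extend-product f (p-prime ∷ []) (sym (*-identityʳ p))) (*-identityʳ (f p))

  extend-inverse : ∀ f f⁻¹ → (∀ {p} → Prime p → Prime (f p)) → (∀ x → f⁻¹ (f x) ≡ x) →
    ∀ a → extend f⁻¹ (extend f a) ≡ a
  extend-inverse f f⁻¹ f-prime f⁻¹∘f zero = refl
  extend-inverse f f⁻¹ f-prime f⁻¹∘f a@(suc _) = begin
    extend f⁻¹ (product (map f (factors a)))
      ≡⟨ extend-product f⁻¹ (All.map⁺ (All.map f-prime (factors-prime a))) refl ⟩
    product (map f⁻¹ (map f (factors a)))
      ≡⟨ cong product (map-inverse (factors a)) ⟩
    product (factors a)
      ≡⟨ product-factors a ⟨
    a ∎
    where
    open ≡-Reasoning
    map-inverse : ∀ xs → map f⁻¹ (map f xs) ≡ xs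
    map-inverse xs = trans (sym (map-∘ xs)) (trans (map-cong f⁻¹∘f xs) (map-id xs))

  relabelling : ∀ σ σ⁻¹ → (∀ {p} → Prime p → Prime (σ p)) → (∀ {p} → Prime p → Prime (σ⁻¹ p)) →
    (∀ x → σ⁻¹ (σ x) ≡ x) → (∀ x → σ (σ⁻¹ x) ≡ x) → Relabelling
  relabelling σ σ⁻¹ σ-prime σ⁻¹-prime σ⁻¹∘σ σ∘σ⁻¹ = record
    { τ = extend σ
    ; τ⁻¹ = extend σ⁻¹
    ; τ⁻¹∘τ = extend-inverse σ σ⁻¹ σ-prime σ⁻¹∘σ
    ; τ∘τ⁻¹ = extend-inverse σ⁻¹ σ σ⁻¹-prime σ∘σ⁻¹
    ; τ-* = extend-* σ
    ; τ-0 = refl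
    ; τ-1 = extend-product σ [] refl
    ; τ-prime = λ p-prime → subst Prime (sym (extend-prime σ p-prime)) (σ-prime p-prime)
    }

  prime-factor : 1 < n → Σ ℕ λ p → Prime p × p ∣ n
  prime-factor {n@(suc _)} 1<n = head-factor (factors n) (product-factors n) (factors-prime n)
    where
    head-factor : ∀ ps → n ≡ product ps → All Prime ps → Σ ℕ λ p → Prime p × p ∣ n
    head-factor [] n≡1 [] = ⊥-elim (<⇒≢ 1<n (sym n≡1))
    head-factor (p ∷ ps) n≡Πps (p-prime ∷ _) =
      p , p-prime , subst (p ∣_) (sym n≡Πps) (m∣m*n (product ps))

  n∣m! : 1 ≤ n → n ≤ m → n ∣ m !
  n∣m! {suc n} _ n≤m = ∣-trans (m∣m*n (n !)) (m≤n⇒m!∣n! n≤m)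

  prime∣1+n!⇒n<p : Prime p → p ∣ suc (n !) → n < p
  prime∣1+n!⇒n<p {p} {n} p-prime p∣1+n! with n <? p
  ... | yes n<p = n<p
  ... | no n≮p = ⊥-elim (nonTrivial⇒≢1 {{prime⇒nonTrivial p-prime}} (∣1⇒≡1
    (∣m+n∣m⇒∣n (subst (p ∣_) (+-comm 1 (n !)) p∣1+n!)
               (n∣m! (>-nonZero⁻¹ p {{prime⇒nonZero p-prime}}) (≮⇒≥ n≮p)))))

  ∃prime> : ∀ B → Σ ℕ λ q → Prime q × B < q
  ∃prime> B with prime-factor {suc (B !)} (s≤s (1≤n! B))
  ... | q , q-prime , q∣1+B! = q , q-prime , prime∣1+n!⇒n<p q-prime q∣1+B!

  fresh : ℕ → ℕ
  fresh B = proj₁ (∃prime> B)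

  B<fresh : ∀ B → B < fresh B
  B<fresh B = proj₂ (proj₂ (∃prime> B))

  freshPairs : List ℕ → ℕ → List (ℕ × ℕ)
  freshPairs [] B = []
  freshPairs (p ∷ ps) B = (p , fresh B) ∷ freshPairs ps (fresh B)

  freshPairs-prime : ∀ {ps B} → All Prime ps → PrimePairs (freshPairs ps B)
  freshPairs-prime [] = []
  freshPairs-prime {B = B} (p-prime ∷ ps-prime) =
    (p-prime , proj₁ (proj₂ (∃prime> B))) ∷ freshPairs-prime ps-prime

  ≤fresh : ∀ {y B} → y ≤ B → y ≤ fresh B
  ≤fresh {B = B} y≤B = ≤-trans y≤B (<⇒≤ (B<fresh B))

  permute-fresh-∉ : ∀ {B ps} → All (_≤ B) ps → x ≤ B → x ∉ ps → permute (freshPairs ps B) x ≡ x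
  permute-fresh-∉ [] x≤B x∉ps = refl
  permute-fresh-∉ {B = B} {p ∷ _} (_ ∷ ps≤B) x≤B x∉ps = trans
    (cong (transpose p (fresh B)) (permute-fresh-∉ (All.map ≤fresh ps≤B) (≤fresh x≤B) (x∉ps ∘ there)))
    (transpose-other (x∉ps ∘ here) (<⇒≢ (≤-<-trans x≤B (B<fresh B))))

  permute-fresh-∈ : ∀ {B ps} → All (_≤ B) ps → x ≤ B → x ∈ ps → B < permute (freshPairs ps B) x
  permute-fresh-∈ {x} {B} {p ∷ ps} (p≤B ∷ ps≤B) x≤B x∈p∷ps with x ∈? ps
  ... | yes x∈ps = subst (B <_) (sym (transpose-other y≢p y≢q)) (<-trans (B<fresh B) q<y)
    where
    q = fresh B
    y = permute (freshPairs ps q) x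
    q<y : q < y
    q<y = permute-fresh-∈ (All.map ≤fresh ps≤B) (≤fresh x≤B) x∈ps
    y≢p : y ≢ p
    y≢p y≡p = <⇒≱ (<-trans (B<fresh B) q<y) (subst (_≤ B) (sym y≡p) p≤B)
    y≢q : y ≢ q
    y≢q y≡q = <⇒≢ q<y (sym y≡q)
  ... | no x∉ps with x∈p∷ps
  ...   | here refl = subst (B <_)
    (sym (trans (cong (transpose x (fresh B)) (permute-fresh-∉ (All.map ≤fresh ps≤B) (≤fresh x≤B) x∉ps))
                (transpose-a x (fresh B))))
    (B<fresh B)
  ...   | there x∈ps = ⊥-elim (x∉ps x∈ps)

  coprime-product : 1 ≤ m → ∀ {qs} → All (λ q → Prime q × m < q) qs → Coprime (product qs) m
  coprime-product 1≤m [] = Coprime.1-coprimeTo _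
  coprime-product 1≤m ((q-prime , m<q) ∷ qs) =
    coprime-*ˡ (prime⇒coprime q-prime {{>-nonZero 1≤m}} m<q) (coprime-product 1≤m qs)

  relabelling-coprime : ∀ n M → 1 ≤ n → 1 ≤ M → Σ Relabelling λ ρ → Coprime (Relabelling.τ ρ n) M
  relabelling-coprime n@(suc _) M _ 1≤M = ρ , coprime-product 1≤M (All.map⁺ (All.tabulate σp-prime-large))
    where
    l = freshPairs (factors n) (n + M)
    l-prime = freshPairs-prime (factors-prime n)
    ρ = relabelling (permute l) (unpermute l) (permute-prime l-prime) (unpermute-prime l-prime)
                  (unpermute∘permute l) (permute∘unpermute l)
    factor≤n+M : All (_≤ n + M) (factors n)
    factor≤n+M = All.tabulate λ p∈ →
      ≤-trans (∣⇒≤ (subst (_ ∣_) (sym (product-factors n)) (∈⇒∣product p∈))) (m≤m+n n M)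
    σp-prime-large : ∀ {p} → p ∈ factors n → Prime (permute l p) × M < permute l p
    σp-prime-large p∈ = permute-prime l-prime (All.lookup (factors-prime n) p∈) ,
      ≤-<-trans (m≤n+m M n) (permute-fresh-∈ factor≤n+M (All.lookup factor≤n+M p∈) p∈)

  -- Multiplicative functions

  prime-power-split : Prime p → 1 ≤ n → Σ ℕ λ v → Σ ℕ λ m → n ≡ p ^ v * m × ¬ p ∣ m
  prime-power-split {p} {n} p-prime = split n (<-wellFounded n)
    where
    split : ∀ n → Acc _<_ n → 1 ≤ n → Σ ℕ λ v → Σ ℕ λ m → n ≡ p ^ v * m × ¬ p ∣ m
    split n (acc rec) 1≤n with p ∣? n
    ... | no p∤n = 0 , n , sym (*-identityˡ n) , p∤n
    ... | yes (divides zero n≡0) = ⊥-elim (<⇒≢ 1≤n (sym n≡0))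
    ... | yes (divides q@(suc _) n≡q*p) with split q (rec q<n) (s≤s z≤n)
      where
      q<n : q < n
      q<n = subst (q <_) (sym n≡q*p) (m<m*n q p (nonTrivial⇒n>1 p {{prime⇒nonTrivial p-prime}}))
    ...   | v , m , q≡p^v*m , p∤m = suc v , m , n≡p^1+v*m , p∤m
      where
      n≡p^1+v*m : n ≡ p ^ suc v * m
      n≡p^1+v*m = trans n≡q*p (trans (cong (_* p) q≡p^v*m)
        (trans (*-comm (p ^ v * m) p) (sym (*-assoc p (p ^ v) m))))

  divisor-positive : 1 ≤ n → m ∣ n → 1 ≤ m
  divisor-positive {m = zero} 1≤n 0∣n = ⊥-elim (<⇒≢ 1≤n (sym (0∣⇒≡0 0∣n)))
  divisor-positive {m = suc _} _ _ = s≤s z≤n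

  prime∤⇒coprime : Prime p → ¬ p ∣ m → Coprime p m
  prime∤⇒coprime {p} {m} p-prime p∤m (d∣p , d∣m) with prime⇒irreducible p-prime d∣p
  ... | inj₁ d≡1 = d≡1
  ... | inj₂ refl = ⊥-elim (p∤m d∣m)

  coprime-^ˡ : ∀ v → Coprime a m → Coprime (a ^ v) m
  coprime-^ˡ zero a⊥m = Coprime.1-coprimeTo _
  coprime-^ˡ (suc v) a⊥m = coprime-*ˡ a⊥m (coprime-^ˡ v a⊥m)

  multiplicative-ext : ∀ {f h} → Multiplicative f → Multiplicative h →
    (∀ {p} v → Prime p → f (p ^ v) ≡ h (p ^ v)) → ∀ n → 1 ≤ n → f n ≡ h n
  multiplicative-ext {f} {h} (f-1 , f-*) (h-1 , h-*) agree n = go n (<-wellFounded n)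
    where
    go : ∀ n → Acc _<_ n → 1 ≤ n → f n ≡ h n
    go n (acc rec) 1≤n with n ≟ 1
    ... | yes refl = trans f-1 (sym h-1)
    ... | no n≢1 with prime-factor (≤∧≢⇒< 1≤n (n≢1 ∘ sym))
    ...   | p , p-prime , p∣n with prime-power-split p-prime 1≤n
    ...     | v , m , n≡p^v*m , p∤m = begin
      f n               ≡⟨ cong f n≡p^v*m ⟩
      f (p ^ v * m)     ≡⟨ f-* _ _ 1≤p^v 1≤m p^v⊥m ⟩
      f (p ^ v) ℚ.* f m ≡⟨ cong₂ ℚ._*_ (agree v p-prime) (go m (rec m<n) 1≤m) ⟩
      h (p ^ v) ℚ.* h m ≡⟨ h-* _ _ 1≤p^v 1≤m p^v⊥m ⟨
      h (p ^ v * m)     ≡⟨ cong h n≡p^v*m ⟨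
      h n               ∎
      where
      open ≡-Reasoning
      m∣n : m ∣ n
      m∣n = divides (p ^ v) n≡p^v*m
      m<n : m < n
      m<n = ≤∧≢⇒< (∣⇒≤ {{>-nonZero 1≤n}} m∣n) (λ m≡n → p∤m (subst (p ∣_) (sym m≡n) p∣n))
      1≤m : 1 ≤ m
      1≤m = divisor-positive 1≤n m∣n
      1≤p^v : 1 ≤ p ^ v
      1≤p^v = m^n>0 p {{prime⇒nonZero p-prime}} v
      p^v⊥m : Coprime (p ^ v) m
      p^v⊥m = coprime-^ˡ v (prime∤⇒coprime p-prime p∤m)

  isNu-prime-power : Prime p → ∀ v → IsNu (p ^ suc v) (suc v ∷ [])
  isNu-prime-power {p} p-prime v =
    p ∷ [] , refl , p-prime ∷ [] , [] ∷ [] , [-] , s≤s z≤n ∷ [] , sym (*-identityʳ (p ^ suc v))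

  module _ {Υ : ℕ → ℚ} (Υ-mult : Multiplicative Υ) (Υ-ν : DependsOnlyOnNu Υ) (ρ : Relabelling) where
    open Relabelling ρ

    multiplicative-∘τ : Multiplicative (Υ ∘ τ)
    multiplicative-∘τ = trans (cong Υ τ-1) (proj₁ Υ-mult) , λ a b 1≤a 1≤b a⊥b →
      trans (cong Υ (τ-* a b)) (proj₂ Υ-mult _ _ (τ-positive 1≤a) (τ-positive 1≤b) (τ-coprime a⊥b))

    Υ∘τ≡Υ : ∀ n → 1 ≤ n → Υ (τ n) ≡ Υ n
    Υ∘τ≡Υ = multiplicative-ext multiplicative-∘τ Υ-mult prime-powers
      where
      prime-powers : ∀ {p} v → Prime p → Υ (τ (p ^ v)) ≡ Υ (p ^ v)
      prime-powers zero _ = cong Υ τ-1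
      prime-powers {p} (suc v) p-prime = trans (cong Υ (τ-^ p (suc v)))
        (Υ-ν _ _ _ (isNu-prime-power (τ-prime p-prime) v) (isNu-prime-power p-prime v))

  -- Bounds on all powers

  ^-distrib-* : ∀ a b m → (a * b) ^ m ≡ a ^ m * b ^ m
  ^-distrib-* a b zero = refl
  ^-distrib-* a b (suc m) = trans (cong (a * b *_) (^-distrib-* a b m)) (interchange a b (a ^ m) (b ^ m))

  -- Bernoulli's inequality (1 + 1/X)^m ≥ 1 + m/X, cleared of denominators.
  bernoulli : ∀ X m → X ^ m * (X + m) ≤ suc X ^ m * X
  bernoulli X zero = ≤-reflexive (+-identityʳ (X + 0))
  bernoulli X (suc m) = begin
    X ^ suc m * (X + suc m)           ≡⟨ expand X (X ^ m) m ⟩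
    X * (X ^ m * (X + m)) + X ^ m * X ≤⟨ +-mono-≤ (*-monoʳ-≤ X IH)
                                                  (≤-trans (*-monoʳ-≤ (X ^ m) (m≤m+n X m)) IH) ⟩
    X * R + R                         ≡⟨ +-comm (X * R) R ⟩
    suc X * R                         ≡⟨ *-assoc (suc X) (suc X ^ m) X ⟨
    suc X ^ suc m * X                 ∎
    where
    open ≤-Reasoning
    IH = bernoulli X m
    R = suc X ^ m * X
    expand : ∀ X P m → (X * P) * (X + suc m) ≡ X * (P * (X + m)) + P * X
    expand = solve 3 (λ X P m → (X :* P) :* (X :+ (con 1 :+ m)) := X :* (P :* (X :+ m)) :+ P :* X) refl
      where open +-*-Solver

  -- If A > X, then A^M outgrows c·X^M by the time M exceeds c·X.
  power-bounds⇒≤ : ∀ {e c A X} → 1 ≤ e → (∀ m → e * A ^ suc m ≤ c * X ^ suc m) → A ≤ X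
  power-bounds⇒≤ {e} {c} {A} {X} 1≤e bound with A ≤? X
  ... | yes A≤X = A≤X
  ... | no A≰X with X
  ...   | zero = ⊥-elim (<⇒≱ (*-mono-≤ 1≤e (≤-trans (≰⇒> A≰X) (≤-reflexive (sym (*-identityʳ A)))))
                             (≤-trans (bound 0) (≤-reflexive (*-zeroʳ c))))
  ...   | X@(suc _) = ⊥-elim (<⇒≱ (n<1+n (c * X)) (≤-trans (m≤n+m (suc (c * X)) X) X+M≤cX))
    where
    M = suc (c * X)
    X+M≤cX : X + M ≤ c * X
    X+M≤cX = *-cancelˡ-≤ (X ^ M) {{m^n≢0 X M}} (begin
      X ^ M * (X + M) ≤⟨ bernoulli X M ⟩
      suc X ^ M * X   ≤⟨ *-monoˡ-≤ X (^-monoˡ-≤ M (≰⇒> A≰X)) ⟩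
      A ^ M * X       ≤⟨ *-monoˡ-≤ X (m≤n*m (A ^ M) e {{>-nonZero 1≤e}}) ⟩
      e * A ^ M * X   ≤⟨ *-monoˡ-≤ X (bound (c * X)) ⟩
      c * X ^ M * X   ≡⟨ rearrange c (X ^ M) X ⟩
      X ^ M * (c * X) ∎)
      where
      open ≤-Reasoning
      rearrange : ∀ c P X → c * P * X ≡ P * (c * X)
      rearrange = solve 3 (λ c P X → c :* P :* X := P :* (c :* X)) refl
        where open +-*-Solver

  toℚᵘ-ℕ→ℚ : ∀ x → toℚᵘ (ℕ→ℚ x) ≡ mkℚᵘ (+ x) 0
  toℚᵘ-ℕ→ℚ x = cong toℚᵘ (ℚP.normalize-coprime (Coprime.sym (Coprime.1-coprimeTo x)))

  toℚᵘ-^ : ∀ y m → toℚᵘ (y ^ℚ m) ℚᵘ.≃ toℚᵘ y ^ᵘ m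
  toℚᵘ-^ y zero = ℚᵘP.≃-refl
  toℚᵘ-^ y (suc m) = ℚᵘP.≃-trans (ℚP.toℚᵘ-homo-* y (y ^ℚ m)) (ℚᵘP.*-congˡ {toℚᵘ y} (toℚᵘ-^ y m))

  ↥-* : ∀ p q → ↥ (p ℚᵘ.* q) ≡ ↥ p ℤ.* ↥ q
  ↥-* (mkℚᵘ _ _) (mkℚᵘ _ _) = refl

  ↧ₙ-* : ∀ p q → ↧ₙ (p ℚᵘ.* q) ≡ ↧ₙ p * ↧ₙ q
  ↧ₙ-* (mkℚᵘ _ _) (mkℚᵘ _ _) = refl

  +-* : ∀ a b → + a ℤ.* + b ≡ + (a * b)
  +-* a b = sym (ℤP.pos-* a b)

  ↥-^ : ∀ a d m → ↥ (mkℚᵘ (+ a) d ^ᵘ m) ≡ + (a ^ m)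
  ↥-^ a d zero = refl
  ↥-^ a d (suc m) = trans (↥-* (mkℚᵘ (+ a) d) (mkℚᵘ (+ a) d ^ᵘ m))
    (trans (cong (+ a ℤ.*_) (↥-^ a d m)) (+-* a (a ^ m)))

  ↧ₙ-^ : ∀ a d m → ↧ₙ (mkℚᵘ (+ a) d ^ᵘ m) ≡ suc d ^ m
  ↧ₙ-^ a d zero = refl
  ↧ₙ-^ a d (suc m) = trans (↧ₙ-* (mkℚᵘ (+ a) d) (mkℚᵘ (+ a) d ^ᵘ m)) (cong (suc d *_) (↧ₙ-^ a d m))

  ≤ᵘ⇔cross-≤ : ∀ {p q P Q} → ↥ p ≡ + P → ↥ q ≡ + Q → p ℚᵘ.≤ q ⇔ P * ↧ₙ q ≤ Q * ↧ₙ p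
  ≤ᵘ⇔cross-≤ {p} {q} {P} {Q} ↥p≡P ↥q≡Q = mk⇔
    (λ { (*≤* ≤) → ℤP.drop‿+≤+ (subst₂ ℤ._≤_ left right ≤) })
    (λ ≤ → *≤* (subst₂ ℤ._≤_ (sym left) (sym right) (+≤+ ≤)))
    where
    left = trans (cong (ℤ._* ℚᵘ.↧ q) ↥p≡P) (+-* P (↧ₙ q))
    right = trans (cong (ℤ._* ℚᵘ.↧ p) ↥q≡Q) (+-* Q (↧ₙ p))

  -- For y < 0 the case m = 0 suffices; for y ≥ 0 clear the denominators of C and y.
  power-bounds⇒≤ℚ : ∀ (C y : ℚ) L k → ℕ→ℚ 1 ℚ.≤ C →
    (∀ m → ℕ→ℚ (L ^ suc m) ℚ.≤ C ℚ.* ℕ→ℚ (k ^ suc m) ℚ.* y ^ℚ suc m) → ℕ→ℚ L ℚ.≤ ℕ→ℚ k ℚ.* y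
  power-bounds⇒≤ℚ (mkℚ -[1+ _ ] _ _) y L k (ℚ.*≤* ()) bound
  power-bounds⇒≤ℚ C y@(mkℚ -[1+ _ ] _ _) L k 1≤C bound = begin
    ℕ→ℚ L                           ≡⟨ cong ℕ→ℚ (*-identityʳ L) ⟨
    ℕ→ℚ (L ^ 1)                     ≤⟨ bound 0 ⟩
    C ℚ.* ℕ→ℚ (k ^ 1) ℚ.* y ^ℚ 1    ≡⟨ cong₂ (λ u v → C ℚ.* ℕ→ℚ u ℚ.* v)
                                             (*-identityʳ k) (ℚP.*-identityʳ y) ⟩
    C ℚ.* ℕ→ℚ k ℚ.* y               ≡⟨ ℚP.*-assoc C (ℕ→ℚ k) y ⟩
    C ℚ.* (ℕ→ℚ k ℚ.* y)             ≤⟨ ℚP.*-monoʳ-≤-nonPos (ℕ→ℚ k ℚ.* y) {{ky≤0}} 1≤C ⟩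
    ℕ→ℚ 1 ℚ.* (ℕ→ℚ k ℚ.* y)         ≡⟨ ℚP.*-identityˡ (ℕ→ℚ k ℚ.* y) ⟩
    ℕ→ℚ k ℚ.* y                     ∎
    where
    open ℚP.≤-Reasoning
    ky≤0 = ℚP.nonNeg*nonPos⇒nonPos (ℕ→ℚ k) {{ℚP.normalize-nonNeg k 1}} y {{ℚP.neg⇒nonPos y}}
  power-bounds⇒≤ℚ C@(mkℚ (+ c) dc _) y@(mkℚ (+ a) dy _) L k 1≤C bound =
    ℚP.toℚᵘ-cancel-≤ (ℚᵘP.≤-respˡ-≃ (ℚᵘP.≃-reflexive (sym (toℚᵘ-ℕ→ℚ L)))
                                    (ℚᵘP.≤-respʳ-≃ (ℚᵘP.≃-sym toℚᵘ-ky) boundᵘ))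
    where
    B = suc dy
    toℚᵘ-ky : toℚᵘ (ℕ→ℚ k ℚ.* y) ℚᵘ.≃ mkℚᵘ (+ k) 0 ℚᵘ.* mkℚᵘ (+ a) dy
    toℚᵘ-ky = ℚᵘP.≃-trans (ℚP.toℚᵘ-homo-* (ℕ→ℚ k) y) (ℚᵘP.*-congʳ (ℚᵘP.≃-reflexive (toℚᵘ-ℕ→ℚ k)))

    cross-bound : ∀ m → suc dc * (L * B) ^ suc m ≤ c * (k * a) ^ suc m
    cross-bound m = begin
      suc dc * (L * B) ^ M          ≡⟨ cong (suc dc *_) (^-distrib-* L B M) ⟩
      suc dc * (L ^ M * B ^ M)      ≡⟨ shuffle (suc dc) (L ^ M) (B ^ M) ⟩
      L ^ M * (suc dc * 1 * B ^ M)  ≡⟨ cong (L ^ M *_) ↧ₙR ⟨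
      L ^ M * ↧ₙ R                  ≤⟨ Equivalence.to (≤ᵘ⇔cross-≤ refl ↥R) boundᵘ ⟩
      c * k ^ M * a ^ M * 1         ≡⟨ trans (*-identityʳ _) (*-assoc c (k ^ M) (a ^ M)) ⟩
      c * (k ^ M * a ^ M)           ≡⟨ cong (c *_) (^-distrib-* k a M) ⟨
      c * (k * a) ^ M               ∎
      where
      open ≤-Reasoning
      M = suc m
      R = mkℚᵘ (+ c) dc ℚᵘ.* mkℚᵘ (+ (k ^ M)) 0 ℚᵘ.* mkℚᵘ (+ a) dy ^ᵘ M
      ↥R : ↥ R ≡ + (c * k ^ M * a ^ M)
      ↥R = trans (↥-* (mkℚᵘ (+ c) dc ℚᵘ.* mkℚᵘ (+ (k ^ M)) 0) (mkℚᵘ (+ a) dy ^ᵘ M))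
        (trans (cong₂ ℤ._*_ (trans (↥-* (mkℚᵘ (+ c) dc) (mkℚᵘ (+ (k ^ M)) 0)) (+-* c (k ^ M)))
                            (↥-^ a dy M))
               (+-* (c * k ^ M) (a ^ M)))
      ↧ₙR : ↧ₙ R ≡ suc dc * 1 * B ^ M
      ↧ₙR = trans (↧ₙ-* (mkℚᵘ (+ c) dc ℚᵘ.* mkℚᵘ (+ (k ^ M)) 0) (mkℚᵘ (+ a) dy ^ᵘ M))
        (cong₂ _*_ (↧ₙ-* (mkℚᵘ (+ c) dc) (mkℚᵘ (+ (k ^ M)) 0)) (↧ₙ-^ a dy M))
      toℚᵘ-rhs : toℚᵘ (C ℚ.* ℕ→ℚ (k ^ M) ℚ.* y ^ℚ M) ℚᵘ.≃ R
      toℚᵘ-rhs = ℚᵘP.≃-trans (ℚP.toℚᵘ-homo-* (C ℚ.* ℕ→ℚ (k ^ M)) (y ^ℚ M))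
        (ℚᵘP.*-cong (ℚᵘP.≃-trans (ℚP.toℚᵘ-homo-* C (ℕ→ℚ (k ^ M)))
                                (ℚᵘP.*-congˡ {toℚᵘ C} (ℚᵘP.≃-reflexive (toℚᵘ-ℕ→ℚ (k ^ M)))))
                    (toℚᵘ-^ y M))
      boundᵘ : mkℚᵘ (+ (L ^ M)) 0 ℚᵘ.≤ R
      boundᵘ = ℚᵘP.≤-respˡ-≃ (ℚᵘP.≃-reflexive (toℚᵘ-ℕ→ℚ (L ^ M)))
                 (ℚᵘP.≤-respʳ-≃ toℚᵘ-rhs (ℚP.toℚᵘ-mono-≤ (bound m)))
      shuffle : ∀ e P B → e * (P * B) ≡ P * (e * 1 * B)
      shuffle = solve 3 (λ e P B → e :* (P :* B) := P :* (e :* con 1 :* B)) refl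
        where open +-*-Solver

    LB≤ka : L * B ≤ k * a
    LB≤ka = power-bounds⇒≤ {suc dc} {c} (s≤s z≤n) cross-bound

    boundᵘ : mkℚᵘ (+ L) 0 ℚᵘ.≤ mkℚᵘ (+ k) 0 ℚᵘ.* mkℚᵘ (+ a) dy
    boundᵘ = Equivalence.from (≤ᵘ⇔cross-≤ refl (trans (↥-* (mkℚᵘ (+ k) 0) (mkℚᵘ (+ a) dy)) (+-* k a)))
      (subst₂ _≤_ (cong (L *_) (sym (*-identityˡ B))) (sym (*-identityʳ (k * a))) LB≤ka)

  -- Tensor powers

  module _ {Υ : ℕ → ℚ} (Υ-mult : Multiplicative Υ) (Υ-ν : DependsOnlyOnNu Υ)
           {j k n} (1≤n : 1 ≤ n) (G : KRegularMap j k n) where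
    open KRegularMap using (size)

    tensor-power : ∀ m → Σ ℕ λ N → 1 ≤ N × Υ N ≡ Υ n ^ℚ suc m ×
                   Σ (KRegularMap j (k ^ suc m) N) λ H → size H ≡ size G ^ suc m
    tensor-power zero = n , 1≤n , sym (ℚP.*-identityʳ (Υ n)) , G¹ , sym (*-identityʳ (size G))
      where
      module G = KRegularMap G
      G¹ : KRegularMap j (k ^ 1) n
      G¹ = record { U = G.U ; g = G.g ; regular = G.regular
                  ; kRegular = subst (λ k′ → KRegular n j k′ G.U G.g) (sym (*-identityʳ k)) G.kRegular }
    tensor-power (suc m) with tensor-power m
    ... | N , 1≤N , ΥN≡ , H , sizeH≡ with relabelling-coprime n N 1≤n 1≤N
    ...   | ρ , τn⊥N = τ n * N , *-mono-≤ (τ-positive 1≤n) 1≤N , ΥτnN≡ ,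
                       Product.kRegularMap τn⊥N G′ H ,
                       trans (Product.size≡ τn⊥N G′ H) (cong₂ _*_ (Relabel.size≡ ρ G) sizeH≡)
      where
      open Relabelling ρ
      G′ = Relabel.kRegularMap ρ G
      ΥτnN≡ : Υ (τ n * N) ≡ Υ n ^ℚ suc (suc m)
      ΥτnN≡ = trans (proj₂ Υ-mult _ _ (τ-positive 1≤n) 1≤N τn⊥N)
                    (cong₂ ℚ._*_ (Υ∘τ≡Υ Υ-mult Υ-ν ρ n 1≤n) ΥN≡)

    size-power-bound : ∀ C → (∀ k n → 1 ≤ k → 1 ≤ n → E≤ j k n (C ℚ.* ℕ→ℚ k ℚ.* Υ n)) → 1 ≤ k →
      ∀ m → ℕ→ℚ (size G ^ suc m) ℚ.≤ C ℚ.* ℕ→ℚ (k ^ suc m) ℚ.* Υ n ^ℚ suc m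
    size-power-bound C E-bound 1≤k m with tensor-power m
    ... | N , 1≤N , ΥN≡ , H , sizeH≡ =
      subst₂ ℚ._≤_ (cong ℕ→ℚ sizeH≡) (cong (C ℚ.* ℕ→ℚ (k ^ suc m) ℚ.*_) ΥN≡)
      (E-bound (k ^ suc m) N (m^n>0 k {{>-nonZero 1≤k}} (suc m)) 1≤N H.U H.g H.regular H.kRegular)
      where module H = KRegularMap H

open import Data.Nat using (ℕ; _≤_)
open import Data.Rational using (ℚ; _*_) renaming (_≤_ to _≤ℚ_)

lemma3 : (j : ℕ) → 1 ≤ j → (C : ℚ) → ℕ→ℚ 1 ≤ℚ C → (Υ : ℕ → ℚ) →
    Multiplicative Υ → DependsOnlyOnNu Υ →
    (∀ k n → 1 ≤ k → 1 ≤ n → E≤ j k n (C * ℕ→ℚ k * Υ n)) →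
    ∀ k n → 1 ≤ k → 1 ≤ n → E≤ j k n (ℕ→ℚ k * Υ n)
lemma3 j _ C 1≤C Υ Υ-mult Υ-ν E-bound k n 1≤k 1≤n U g regular kRegular =
  power-bounds⇒≤ℚ C (Υ n) (KRegularMap.size G) k 1≤C
    (size-power-bound Υ-mult Υ-ν 1≤n G C E-bound 1≤k)
  where
  G : KRegularMap j k n
  G = record { U = U ; g = g ; regular = regular ; kRegular = kRegular }
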